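{- For every integer $n \geq 8$ and every integer $\nu$ with $2 < \nu < \frac{n+2}{3}$, there exists a finite simple $2$-connected graph $G$ on $n$ vertices with minimum degree $\delta(G) = \nu$ such that $G$ contains no cycle $W$ for which the set $V(G)\setminus V(W)$ of vertices not on $W$ is an independent set.
   Context: Graphs are finite, simple and undirected. $\delta(G)$ denotes the minimum degree of $G$. A set of vertices is independent if no two of its vertices are adjacent. A cycle has at least $3$ vertices. -}

module Defs where

open import Data.Nat using (ℕ; zero; suc; _≤_; _<_)
open import Data.Fin using (Fin)
open import Data.Fin.Properties using (_≟_)
open import Data.Bool using (Bool; true; false; T; T?)
open import Data.Empty using (⊥)
open import Data.List using (List; []; _∷_; length; filter; head; last)
open import Data.List.Membership.Propositional using (_∈_; _∉_)
open import Data.List.Relation.Unary.Unique.Propositional using (Unique)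
open import Data.List.Relation.Binary.Pointwise using ()
open import Data.Maybe using (Maybe; just; nothing)
open import Data.Product using (Σ; ∃; _×_; _,_)
open import Data.Vec.Functional using (Vector)
open import Relation.Nullary using (¬_)
open import Relation.Binary.PropositionalEquality using (_≡_; _≢_)
import Data.Vec as Vec

record Graph (n : ℕ) : Set where
  field
    adj   : Fin n → Fin n → Bool
    sym   : ∀ u v → adj u v ≡ adj v u
    irrefl : ∀ v → adj v v ≡ false
open Graph public

Adj : ∀ {n} → Graph n → Fin n → Fin n → Set
Adj G u v = T (adj G u v)

vertices : (n : ℕ) → List (Fin n)
vertices n = Vec.toList (Vec.allFin n)

degree : ∀ {n} → Graph n → Fin n → ℕ
degree {n} G v = length (filter (λ u → T? (adj G v u)) (vertices n))

MinDegree≡ : ∀ {n} → Graph n → ℕ → Set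
MinDegree≡ G ν = (∀ v → ν ≤ degree G v) × ∃ λ v → degree G v ≡ ν

data AdjChain {n} (G : Graph n) : List (Fin n) → Set where
  [] : AdjChain G []
  [-] : ∀ v → AdjChain G (v ∷ [])
  _∷_ : ∀ {u v vs} → Adj G u v → AdjChain G (v ∷ vs) → AdjChain G (u ∷ v ∷ vs)

PathAvoiding : ∀ {n} → Graph n → Fin n → Fin n → Fin n → Set
PathAvoiding {n} G x s t =
  Σ (List (Fin n)) λ p → AdjChain G p × head p ≡ just s × last p ≡ just t × x ∉ p

Path : ∀ {n} → Graph n → Fin n → Fin n → Set
Path {n} G s t =
  Σ (List (Fin n)) λ p → AdjChain G p × head p ≡ just s × last p ≡ just t

Connected : ∀ {n} → Graph n → Set
Connected G = ∀ s t → Path G s t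

TwoConnected : ∀ {n} → Graph n → Set
TwoConnected {n} G =
  3 ≤ n × Connected G ×
  (∀ x s t → s ≢ x → t ≢ x → PathAvoiding G x s t)

IsCycle : ∀ {n} → Graph n → List (Fin n) → Set
IsCycle G [] = ⊥
IsCycle G (v ∷ vs) =
  3 ≤ length (v ∷ vs) × Unique (v ∷ vs) × AdjChain G (v ∷ vs) ×
  (∀ w → last (v ∷ vs) ≡ just w → Adj G w v)

Independent : ∀ {n} → Graph n → (Fin n → Set) → Set
Independent G S = ∀ u v → S u → S v → ¬ Adj G u v

{-# OPTIONS --safe #-}
-- Let k = ν - 1. Join an independent set of k hubs completely to the disjoint union of
-- k + 1 cliques with at least two vertices each (k edges and one clique on the remaining
-- n - 3k vertices). A vertex of a clique of size two has degree k + 1 = ν and no vertex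
-- has less; any two vertices are joined through either of two hubs or either of two
-- clique vertices, so the graph is 2-connected. If W were a cycle with V ∖ W independent,
-- W would meet every clique, and since the neighbours of a clique outside it are hubs, W
-- would leave every clique along an edge into a hub. A hub has a unique predecessor on W,
-- so the k + 1 cliques would need k + 1 distinct hubs.
module Submission where

open import Defs hiding (sym)
open import Data.Bool using (Bool; true; false; not; _∧_; if_then_else_; T; T?)
open import Data.Bool.Properties using (T-≡; T-∧; ¬-not; ∧-zeroʳ)
open import Data.Empty using (⊥; ⊥-elim)
open import Data.Fin as Fin using (Fin; toℕ; fromℕ<)
import Data.Fin.Properties as Fin
open import Data.List using (List; []; _∷_; head; last; length; filter)
open import Data.List.Membership.Propositional using (_∈_; _∉_)
import Data.List.Membership.DecPropositional as DecMembership
open import Data.List.Relation.Unary.All as All using (All; []; _∷_)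
open import Data.List.Relation.Unary.All.Properties using (All¬⇒¬Any)
open import Data.List.Relation.Unary.AllPairs using (_∷_)
open import Data.List.Relation.Unary.Any using (here; there)
open import Data.List.Relation.Unary.Unique.Propositional using (Unique)
open import Data.Maybe using (just)
open import Data.Maybe.Properties using (just-injective)
open import Data.Nat using (ℕ; zero; suc; _+_; _*_; _∸_; _⊓_; _≤_; _<_; _≡ᵇ_; _<?_; ⌊_/2⌋; z≤n; s≤s; s≤s⁻¹)
import Data.Nat.Properties as ℕ
open import Data.Nat.Tactic.RingSolver using (solve-∀)
open import Data.Product using (Σ; ∃; ∃₂; _×_; _,_; proj₁; proj₂)
open import Data.Sum using (_⊎_; inj₁; inj₂; [_,_]′)
open import Data.Sum.Properties using (inj₁-injective; ≡-dec)
open import Data.Unit using (⊤; tt)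
open import Function using (_∘_)
open import Function.Bundles using (Equivalence)
open import Relation.Binary.Definitions using (DecidableEquality)
open import Relation.Binary.PropositionalEquality hiding ([_])
open import Relation.Nullary using (¬_; yes; no)
open import Relation.Unary using (Decidable)
import Data.Vec as Vec

≡ᵇ-sym : ∀ i j → (i ≡ᵇ j) ≡ (j ≡ᵇ i)
≡ᵇ-sym zero    zero    = refl
≡ᵇ-sym zero    (suc j) = refl
≡ᵇ-sym (suc i) zero    = refl
≡ᵇ-sym (suc i) (suc j) = ≡ᵇ-sym i j

≡⇒≡ᵇ≡true : ∀ {i j} → i ≡ j → (i ≡ᵇ j) ≡ true
≡⇒≡ᵇ≡true {i} {j} i≡j = Equivalence.to T-≡ (ℕ.≡⇒≡ᵇ i j i≡j)

≢⇒≡ᵇ≡false : ∀ {i j} → i ≢ j → (i ≡ᵇ j) ≡ false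
≢⇒≡ᵇ≡false {i} {j} i≢j = ¬-not (i≢j ∘ ℕ.≡ᵇ⇒≡ i j ∘ Equivalence.from T-≡)

one-avoids : ∀ {A : Set} {P : A → Set} → DecidableEquality A →
             ∀ {a b} → P a → P b → a ≢ b → ∀ x → ∃ λ c → P c × x ≢ c
one-avoids _≟_ {a} {b} Pa Pb a≢b x with x ≟ a
... | yes refl = b , Pb , a≢b
... | no  x≢a  = a , Pa , x≢a

count : ℕ → (ℕ → Bool) → ℕ
count zero    f = 0
count (suc m) f = (if f 0 then 1 else 0) + count m (f ∘ suc)

count-cong : ∀ {m f g} → (∀ i → f i ≡ g i) → count m f ≡ count m g
count-cong {zero}      f≗g = refl
count-cong {suc m} {g = g} f≗g rewrite f≗g 0 =
  cong ((if g 0 then 1 else 0) +_) (count-cong {m} (f≗g ∘ suc))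

count-+ : ∀ a b f → count (a + b) f ≡ count a f + count b (λ i → f (a + i))
count-+ zero    b f = refl
count-+ (suc a) b f = trans (cong ((if f 0 then 1 else 0) +_) (count-+ a b (f ∘ suc)))
                            (sym (ℕ.+-assoc (if f 0 then 1 else 0) (count a (f ∘ suc)) _))

count-split : ∀ {a m} f → a ≤ m → count m f ≡ count a f + count (m ∸ a) (λ i → f (a + i))
count-split {a} {m} f a≤m =
  trans (cong (λ l → count l f) (sym (ℕ.m+[n∸m]≡n a≤m))) (count-+ a (m ∸ a) f)

count-all : ∀ {m f} → (∀ i → i < m → f i ≡ true) → count m f ≡ m
count-all {zero}      _   = refl
count-all {suc m} all rewrite all 0 (s≤s z≤n) = cong suc (count-all (λ i i<m → all (suc i) (s≤s i<m)))

count-none : ∀ {m f} → (∀ i → f i ≡ false) → count m f ≡ 0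
count-none {zero}      _    = refl
count-none {suc m} none rewrite none 0 = count-none {m} (none ∘ suc)

count-singleton : ∀ {m} j → j < m → count m (λ i → i ≡ᵇ j) ≡ 1
count-singleton {suc m} zero    _         = cong suc (count-none {m} (λ _ → refl))
count-singleton {suc m} (suc j) (s≤s j<m) = count-singleton j j<m

count-positive : ∀ {m f} j → j < m → f j ≡ true → 1 ≤ count m f
count-positive {suc m} zero    _         f0≡true rewrite f0≡true = s≤s z≤n
count-positive {suc m}     (suc j) (s≤s j<m) fj≡true =
  ℕ.≤-trans (count-positive j j<m fj≡true) (ℕ.m≤n+m _ _)

graphOnℕ : ∀ n (A : ℕ → ℕ → Bool) → (∀ i j → A i j ≡ A j i) → (∀ i → A i i ≡ false) →
           Graph n
graphOnℕ n A A-sym A-irrefl = record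
  { adj    = λ u v → A (toℕ u) (toℕ v)
  ; sym    = λ u v → A-sym (toℕ u) (toℕ v)
  ; irrefl = A-irrefl ∘ toℕ
  }

length-filter-tabulate : ∀ {X : Set} m (g : Fin m → X) (P : X → Bool) (f : ℕ → Bool) →
  (∀ i → P (g i) ≡ f (toℕ i)) →
  length (filter (λ x → T? (P x)) (Vec.toList (Vec.tabulate g))) ≡ count m f
length-filter-tabulate zero    g P f P∘g≗f = refl
length-filter-tabulate (suc m) g P f P∘g≗f
  with P (g Fin.zero) | P∘g≗f Fin.zero
     | length-filter-tabulate m (g ∘ Fin.suc) P (f ∘ suc) (P∘g≗f ∘ Fin.suc)
... | true  | P≡f | tail rewrite sym P≡f = cong suc tail
... | false | P≡f | tail rewrite sym P≡f = tail

degree-graphOnℕ : ∀ {n A A-sym A-irrefl} v →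
  degree (graphOnℕ n A A-sym A-irrefl) v ≡ count n (A (toℕ v))
degree-graphOnℕ {n} {A} v =
  length-filter-tabulate n (λ u → u) (λ u → A (toℕ v) (toℕ u)) (A (toℕ v)) (λ _ → refl)

PathWithin : ∀ {n} → Graph n → (Fin n → Set) → Fin n → Fin n → Set
PathWithin {n} G Q s t =
  Σ (List (Fin n)) λ p → AdjChain G p × head p ≡ just s × last p ≡ just t × All Q p

PathWithin⇒Path : ∀ {n} {G : Graph n} {Q s t} → PathWithin G Q s t → Path G s t
PathWithin⇒Path (p , chain , head≡ , last≡ , _) = p , chain , head≡ , last≡

PathWithin⇒PathAvoiding : ∀ {n} {G : Graph n} {x s t} →
  PathWithin G (x ≢_) s t → PathAvoiding G x s t
PathWithin⇒PathAvoiding (p , chain , head≡ , last≡ , avoids) =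
  p , chain , head≡ , last≡ , All¬⇒¬Any avoids

data Consecutive {A : Set} : List A → A → A → Set where
  here  : ∀ {x y xs} → Consecutive (x ∷ y ∷ xs) x y
  there : ∀ {z xs x y} → Consecutive xs x y → Consecutive (z ∷ xs) x y

CyclicallyConsecutive : {A : Set} → List A → A → A → Set
CyclicallyConsecutive xs x y = Consecutive xs x y ⊎ (last xs ≡ just x × head xs ≡ just y)

record Exit {A : Set} (R : A → A → Set) (P : A → Set) : Set where
  constructor exit
  field
    from to : A
    step    : R from to
    inside  : P from
    outside : ¬ P to

Exit-map : ∀ {A : Set} {R R′ : A → A → Set} {P : A → Set} →
           (∀ {x y} → R x y → R′ x y) → Exit R P → Exit R′ P
Exit-map f (exit x y r Px ¬Py) = exit x y (f r) Px ¬Py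

last-∷ : ∀ {A : Set} (x : A) xs → ∃ λ l → last (x ∷ xs) ≡ just l
last-∷ x []       = x , refl
last-∷ x (y ∷ ys) = last-∷ y ys

last-∈ : ∀ {A : Set} (xs : List A) {l} → last xs ≡ just l → l ∈ xs
last-∈ (x ∷ [])     last≡ = here (sym (just-injective last≡))
last-∈ (x ∷ y ∷ ys) last≡ = there (last-∈ (y ∷ ys) last≡)

module _ {A : Set} {P : A → Set} (P? : Decidable P) where

  exit-from-head : ∀ {x xs z} → P x → z ∈ x ∷ xs → ¬ P z → Exit (Consecutive (x ∷ xs)) P
  exit-from-head Px (here refl) ¬Pz = ⊥-elim (¬Pz Px)
  exit-from-head {x} {w ∷ ws} Px (there z∈) ¬Pz with P? w
  ... | yes Pw  = Exit-map there (exit-from-head Pw z∈ ¬Pz)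
  ... | no  ¬Pw = exit x w here Px ¬Pw

  exit-before-last : ∀ {xs y l} → y ∈ xs → P y → last xs ≡ just l → ¬ P l →
                     Exit (Consecutive xs) P
  exit-before-last {x ∷ xs} y∈ Py last≡ ¬Pl with P? x
  ... | yes Px = exit-from-head Px (last-∈ (x ∷ xs) last≡) ¬Pl
  exit-before-last {x ∷ xs}     (here refl) Py last≡ ¬Pl | no ¬Px = ⊥-elim (¬Px Py)
  exit-before-last {x ∷ w ∷ ws} (there y∈)  Py last≡ ¬Pl | no _   =
    Exit-map there (exit-before-last y∈ Py last≡ ¬Pl)

  exit-cyclic : ∀ {xs y z} → y ∈ xs → P y → z ∈ xs → ¬ P z → Exit (CyclicallyConsecutive xs) P
  exit-cyclic {x ∷ xs} y∈ Py z∈ ¬Pz with P? x | last-∷ x xs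
  ... | yes Px  | _ = Exit-map inj₁ (exit-from-head Px z∈ ¬Pz)
  ... | no  ¬Px | l , last≡ with P? l
  ...   | yes Pl  = exit l x (inj₂ (last≡ , refl)) Pl ¬Px
  ...   | no  ¬Pl = Exit-map inj₁ (exit-before-last y∈ Py last≡ ¬Pl)

consecutive-∈-tail : ∀ {A : Set} {z : A} {xs x y} → Consecutive (z ∷ xs) x y → y ∈ xs
consecutive-∈-tail here                    = here refl
consecutive-∈-tail {xs = _ ∷ _} (there c) = there (consecutive-∈-tail c)

consecutive-unique-predecessor : ∀ {A : Set} {xs : List A} {x x′ y} →
  Unique xs → Consecutive xs x y → Consecutive xs x′ y → x ≡ x′
consecutive-unique-predecessor _            here      here       = refl
consecutive-unique-predecessor (_ ∷ y∉ ∷ _) here      (there c′) =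
  ⊥-elim (All.lookup y∉ (consecutive-∈-tail c′) refl)
consecutive-unique-predecessor (_ ∷ y∉ ∷ _) (there c) here       =
  ⊥-elim (All.lookup y∉ (consecutive-∈-tail c) refl)
consecutive-unique-predecessor (_ ∷ unique) (there c) (there c′) = consecutive-unique-predecessor unique c c′

cyclic-unique-predecessor : ∀ {A : Set} {xs : List A} {x x′ y} →
  Unique xs → CyclicallyConsecutive xs x y → CyclicallyConsecutive xs x′ y → x ≡ x′
cyclic-unique-predecessor unique (inj₁ c) (inj₁ c′) = consecutive-unique-predecessor unique c c′
cyclic-unique-predecessor {xs = _ ∷ _} (y∉ ∷ _) (inj₁ c) (inj₂ (_ , refl)) =
  ⊥-elim (All.lookup y∉ (consecutive-∈-tail c) refl)
cyclic-unique-predecessor {xs = _ ∷ _} (y∉ ∷ _) (inj₂ (_ , refl)) (inj₁ c′) =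
  ⊥-elim (All.lookup y∉ (consecutive-∈-tail c′) refl)
cyclic-unique-predecessor _ (inj₂ (last≡ , _)) (inj₂ (last≡′ , _)) =
  just-injective (trans (sym last≡) last≡′)

consecutive-adjacent : ∀ {n} {G : Graph n} {xs x y} → AdjChain G xs → Consecutive xs x y → Adj G x y
consecutive-adjacent (xy ∷ _)    here      = xy
consecutive-adjacent (_ ∷ chain) (there c) = consecutive-adjacent chain c

cycle-adjacent : ∀ {n} {G : Graph n} {W x y} → IsCycle G W → CyclicallyConsecutive W x y → Adj G x y
cycle-adjacent {W = _ ∷ _} (_ , _ , chain , _) (inj₁ c)              = consecutive-adjacent chain c
cycle-adjacent {W = _ ∷ _} (_ , _ , _ , closed) (inj₂ (last≡ , refl)) = closed _ last≡

cycle-unique : ∀ {n} {G : Graph n} {W} → IsCycle G W → Unique W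
cycle-unique {W = _ ∷ _} (_ , unique , _) = unique

record HubBlockPartition {n} (G : Graph n) (m : ℕ) : Set where
  field
    role         : Fin n → Fin (suc m) ⊎ Fin m
    hub-unique   : ∀ {u v h} → role u ≡ inj₂ h → role v ≡ inj₂ h → u ≡ v
    block-closed : ∀ {u v b c} → role u ≡ inj₁ b → role v ≡ inj₁ c → Adj G u v → b ≡ c
    block-edge   : ∀ b → ∃₂ λ u v → role u ≡ inj₁ b × role v ≡ inj₁ b × Adj G u v

module DominatingCycle {n m} {G : Graph n} (H : HubBlockPartition G (suc m))
                       (W : List (Fin n)) (cycle : IsCycle G W)
                       (dominating : Independent G (_∉ W)) where
  open HubBlockPartition H
  open Exit
  open DecMembership (Fin._≟_ {n}) using (_∈?_)

  InBlock : Fin (suc (suc m)) → Fin n → Set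
  InBlock b v = role v ≡ inj₁ b

  block-meets-cycle : ∀ b → ∃ λ v → v ∈ W × InBlock b v
  block-meets-cycle b with block-edge b
  ... | u , v , u∈b , v∈b , uv with u ∈? W | v ∈? W
  ...   | yes u∈W | _       = u , u∈W , u∈b
  ...   | no  _   | yes v∈W = v , v∈W , v∈b
  ...   | no  u∉W | no  v∉W = ⊥-elim (dominating u v u∉W v∉W uv)

  another-block : (b : Fin (suc (suc m))) → ∃ λ c → c ≢ b
  another-block Fin.zero    = Fin.suc Fin.zero , λ ()
  another-block (Fin.suc _) = Fin.zero , λ ()

  exit-of : ∀ b → Exit (CyclicallyConsecutive W) (InBlock b)
  exit-of b with block-meets-cycle b | another-block b
  ... | y , y∈W , y∈b | c , c≢b with block-meets-cycle c
  ...   | z , z∈W , z∈c =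
    exit-cyclic (λ v → ≡-dec Fin._≟_ Fin._≟_ (role v) (inj₁ b))
                y∈W y∈b z∈W (λ z∈b → c≢b (inj₁-injective (trans (sym z∈c) z∈b)))

  exit-to-hub : ∀ {b} (e : Exit (CyclicallyConsecutive W) (InBlock b)) → ∃ λ h → role (to e) ≡ inj₂ h
  exit-to-hub {b} e with role (to e) in role≡
  ... | inj₂ h = h , refl
  ... | inj₁ c = ⊥-elim (outside e (trans role≡ (cong inj₁ (sym b≡c))))
    where
    b≡c : b ≡ c
    b≡c = block-closed (inside e) role≡ (cycle-adjacent cycle (step e))

  exit-hub : ∀ b → ∃ λ h → role (to (exit-of b)) ≡ inj₂ h
  exit-hub b = exit-to-hub (exit-of b)

  hub-of : Fin (suc (suc m)) → Fin (suc m)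
  hub-of b = proj₁ (exit-hub b)

  hub-of-injective : ∀ {b b′} → hub-of b ≡ hub-of b′ → b ≡ b′
  hub-of-injective {b} {b′} same-hub = inj₁-injective (begin
    inj₁ b           ≡⟨ sym (inside e) ⟩
    role (from e)    ≡⟨ cong role from≡ ⟩
    role (from e′)   ≡⟨ inside e′ ⟩
    inj₁ b′          ∎)
    where
    open ≡-Reasoning
    e = exit-of b
    e′ = exit-of b′
    to≡ : to e ≡ to e′
    to≡ = hub-unique (proj₂ (exit-hub b))
                     (subst (λ h → role (to e′) ≡ inj₂ h) (sym same-hub) (proj₂ (exit-hub b′)))
    from≡ : from e ≡ from e′
    from≡ = cyclic-unique-predecessor (cycle-unique cycle) (step e)
              (subst (CyclicallyConsecutive W (from e′)) (sym to≡) (step e′))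

  absurd : ⊥
  absurd = collision (Fin.pigeonhole (ℕ.n<1+n (suc m)) hub-of)
    where
    collision : (∃₂ λ b b′ → b Fin.< b′ × hub-of b ≡ hub-of b′) → ⊥
    collision (b , b′ , b<b′ , same-hub) = Fin.<-irrefl (hub-of-injective same-hub) b<b′

no-dominating-cycle : ∀ {n m} {G : Graph n} → HubBlockPartition G (suc m) →
  ∀ W → IsCycle G W → ¬ Independent G (_∉ W)
no-dominating-cycle H W cycle dominating = DominatingCycle.absurd H W cycle dominating

-- Vertices 0, …, k - 1 are the hubs; vertex k + x lies in block ⌊ x /2⌋ ⊓ k.
module Construction (k n : ℕ) (2≤k : 2 ≤ k) (k+1+2k<n : k + suc (k + k) < n) where

  block : ℕ → ℕ
  block i = ⌊ i ∸ k /2⌋ ⊓ k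

  adjacency : ℕ → ℕ → Bool
  adjacency i j with i <? k | j <? k
  ... | yes _ | yes _ = false
  ... | yes _ | no  _ = true
  ... | no  _ | yes _ = true
  ... | no  _ | no  _ = not (i ≡ᵇ j) ∧ (block i ≡ᵇ block j)

  adjacency-sym : ∀ i j → adjacency i j ≡ adjacency j i
  adjacency-sym i j with i <? k | j <? k
  ... | yes _ | yes _ = refl
  ... | yes _ | no  _ = refl
  ... | no  _ | yes _ = refl
  ... | no  _ | no  _ = cong₂ (λ a b → not a ∧ b) (≡ᵇ-sym i j) (≡ᵇ-sym (block i) (block j))

  adjacency-irrefl : ∀ i → adjacency i i ≡ false
  adjacency-irrefl i with i <? k
  ... | yes _ = refl
  ... | no  _ rewrite ≡⇒≡ᵇ≡true (refl {x = i}) = refl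

  adjacency-hub-member : ∀ {i j} → i < k → k ≤ j → adjacency i j ≡ true
  adjacency-hub-member {i} {j} i<k k≤j with i <? k | j <? k
  ... | yes _   | no  _   = refl
  ... | no  i≮k | _       = ⊥-elim (i≮k i<k)
  ... | yes _   | yes j<k = ⊥-elim (ℕ.<⇒≱ j<k k≤j)

  adjacency-member-hub : ∀ {i j} → k ≤ i → j < k → adjacency i j ≡ true
  adjacency-member-hub {i} {j} k≤i j<k = trans (adjacency-sym i j) (adjacency-hub-member j<k k≤i)

  adjacency-members : ∀ {i j} → k ≤ i → k ≤ j →
                      adjacency i j ≡ (not (i ≡ᵇ j) ∧ (block i ≡ᵇ block j))
  adjacency-members {i} {j} k≤i k≤j with i <? k | j <? k
  ... | no  _   | no  _   = refl
  ... | yes i<k | _       = ⊥-elim (ℕ.<⇒≱ i<k k≤i)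
  ... | no  _   | yes j<k = ⊥-elim (ℕ.<⇒≱ j<k k≤j)

  adjacency-same-block : ∀ {i j} → k ≤ i → k ≤ j → i ≢ j → block i ≡ block j →
                         adjacency i j ≡ true
  adjacency-same-block k≤i k≤j i≢j same
    rewrite adjacency-members k≤i k≤j | ≢⇒≡ᵇ≡false i≢j | ≡⇒≡ᵇ≡true same = refl

  adjacency-other-block : ∀ {i j} → k ≤ i → k ≤ j → block i ≢ block j → adjacency i j ≡ false
  adjacency-other-block {i} {j} k≤i k≤j different
    rewrite adjacency-members k≤i k≤j | ≢⇒≡ᵇ≡false different = ∧-zeroʳ (not (i ≡ᵇ j))

  adjacent-members-same-block : ∀ {i j} → k ≤ i → k ≤ j → T (adjacency i j) → block i ≡ block j
  adjacent-members-same-block {i} {j} k≤i k≤j ij =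
    ℕ.≡ᵇ⇒≡ _ _ (proj₂ (Equivalence.to T-∧ (subst T (adjacency-members k≤i k≤j) ij)))

  block≤k : ∀ i → block i ≤ k
  block≤k i = ℕ.m⊓n≤n ⌊ i ∸ k /2⌋ k

  block-offset : ∀ x → ⌊ x /2⌋ ≤ k → block (k + x) ≡ ⌊ x /2⌋
  block-offset x le = trans (cong (λ y → ⌊ y /2⌋ ⊓ k) (ℕ.m+n∸m≡n k x)) (ℕ.m≤n⇒m⊓n≡m le)

  block-pair₀ : ∀ {b} → b ≤ k → block (k + (b + b)) ≡ b
  block-pair₀ {b} b≤k =
    trans (block-offset (b + b) (subst (_≤ k) (ℕ.n≡⌊n+n/2⌋ b) b≤k)) (sym (ℕ.n≡⌊n+n/2⌋ b))

  block-pair₁ : ∀ {b} → b ≤ k → block (k + suc (b + b)) ≡ b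
  block-pair₁ {b} b≤k =
    trans (block-offset (suc (b + b)) (subst (_≤ k) (ℕ.n≡⌈n+n/2⌉ b) b≤k)) (sym (ℕ.n≡⌈n+n/2⌉ b))

  pair₁<n : ∀ {b} → b ≤ k → k + suc (b + b) < n
  pair₁<n b≤k = ℕ.≤-<-trans (ℕ.+-monoʳ-≤ k (s≤s (ℕ.+-mono-≤ b≤k b≤k))) k+1+2k<n

  pair₀<n : ∀ {b} → b ≤ k → k + (b + b) < n
  pair₀<n b≤k = ℕ.≤-<-trans (ℕ.+-monoʳ-≤ k (ℕ.n≤1+n _)) (pair₁<n b≤k)

  pair₀≢pair₁ : ∀ {b} → k + (b + b) ≢ k + suc (b + b)
  pair₀≢pair₁ {b} eq = ℕ.<-irrefl eq (ℕ.+-monoʳ-< k (ℕ.n<1+n (b + b)))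

  SameBlock : ℕ → ℕ → Set
  SameBlock i j = k ≤ j × j < n × block j ≡ block i

  same-block-pair : ∀ i →
    SameBlock i (k + (block i + block i)) × SameBlock i (k + suc (block i + block i))
  same-block-pair i = (ℕ.m≤m+n k _ , pair₀<n (block≤k i) , block-pair₀ (block≤k i))
                    , (ℕ.m≤m+n k _ , pair₁<n (block≤k i) , block-pair₁ (block≤k i))

  partner : ∀ {i} → k ≤ i → ∃ λ j → k ≤ j × j < n × adjacency i j ≡ true
  partner {i} k≤i
    with one-avoids {P = SameBlock i} ℕ._≟_ (proj₁ (same-block-pair i)) (proj₂ (same-block-pair i))
                    (pair₀≢pair₁ {block i}) i
  ... | j , (k≤j , j<n , same) , i≢j = j , k≤j , j<n , adjacency-same-block k≤i k≤j i≢j (sym same)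

  offset-< : ∀ {x} → k + x < n → x < n ∸ k
  offset-< {x} lt = subst (_< n ∸ k) (ℕ.m+n∸m≡n k x) (ℕ.∸-monoˡ-< lt (ℕ.m≤m+n k x))

  k+1<n : k + 1 < n
  k+1<n = pair₁<n z≤n

  k<n : k < n
  k<n = ℕ.<-trans (ℕ.m<m+n k (s≤s z≤n)) k+1<n

  k≤n : k ≤ n
  k≤n = ℕ.<⇒≤ k<n

  k+k<n : k + k < n
  k+k<n = ℕ.≤-<-trans (ℕ.+-monoʳ-≤ k (ℕ.m≤n⇒m≤1+n (ℕ.m≤m+n k k))) k+1+2k<n

  graph : Graph n
  graph = graphOnℕ n adjacency adjacency-sym adjacency-irrefl

  degree≡count : ∀ v → degree graph v ≡ count n (adjacency (toℕ v))
  degree≡count = degree-graphOnℕ {A = adjacency} {adjacency-sym} {adjacency-irrefl}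

  adjacent : ∀ {u v} → adjacency (toℕ u) (toℕ v) ≡ true → Adj graph u v
  adjacent = Equivalence.from T-≡

  member₀ member₁ : Fin n
  member₀ = fromℕ< k<n
  member₁ = fromℕ< k+1<n

  Hub Member : Fin n → Set
  Hub v = toℕ v < k
  Member v = k ≤ toℕ v

  hub-or-member : ∀ v → Hub v ⊎ Member v
  hub-or-member v with toℕ v <? k
  ... | yes v<k = inj₁ v<k
  ... | no  v≮k = inj₂ (ℕ.≮⇒≥ v≮k)

  open ℕ.≤-Reasoning

  degree-hub : ∀ {v} → Hub v → suc k ≤ degree graph v
  degree-hub {v} v<k = begin
    suc k                                        ≤⟨ offset-< k+k<n ⟩
    n ∸ k                                        ≡⟨ sym (count-all members) ⟩
    count (n ∸ k) (λ x → f (k + x))              ≤⟨ ℕ.m≤n+m _ _ ⟩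
    count k f + count (n ∸ k) (λ x → f (k + x))  ≡⟨ sym (count-split f k≤n) ⟩
    count n f                                    ≡⟨ sym (degree≡count v) ⟩
    degree graph v                               ∎
    where
    f = adjacency (toℕ v)
    members : ∀ x → x < n ∸ k → f (k + x) ≡ true
    members x _ = adjacency-hub-member v<k (ℕ.m≤m+n k x)

  degree-member : ∀ {v} → Member v → suc k ≤ degree graph v
  degree-member {v} k≤v with partner k≤v
  ... | j , k≤j , j<n , f≡true = begin
    suc k                                        ≡⟨ ℕ.+-comm 1 k ⟩
    k + 1                                        ≤⟨ ℕ.+-mono-≤ (ℕ.≤-reflexive (sym hubs)) member ⟩
    count k f + count (n ∸ k) (λ x → f (k + x))  ≡⟨ sym (count-split f k≤n) ⟩
    count n f                                    ≡⟨ sym (degree≡count v) ⟩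
    degree graph v                               ∎
    where
    f = adjacency (toℕ v)
    hubs : count k f ≡ k
    hubs = count-all (λ i i<k → adjacency-member-hub k≤v i<k)
    member : 1 ≤ count (n ∸ k) (λ x → f (k + x))
    member = count-positive (j ∸ k) (ℕ.∸-monoˡ-< j<n k≤j)
               (subst (λ y → f y ≡ true) (sym (ℕ.m+[n∸m]≡n k≤j)) f≡true)

  block-k : block k ≡ 0
  block-k = cong (λ y → ⌊ y /2⌋ ⊓ k) (ℕ.n∸n≡0 k)

  adjacency-k : ∀ x → adjacency k (k + x) ≡ (x ≡ᵇ 1)
  adjacency-k zero          =
    subst (λ j → adjacency k j ≡ false) (sym (ℕ.+-identityʳ k)) (adjacency-irrefl k)
  adjacency-k (suc zero)    = adjacency-same-block ℕ.≤-refl (ℕ.m≤m+n k 1) (ℕ.m+1+n≢m k ∘ sym)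
                                (trans block-k (sym (block-offset 1 z≤n)))
  adjacency-k (suc (suc x)) = adjacency-other-block ℕ.≤-refl (ℕ.m≤m+n k _)
                                (λ same → ℕ.<-irrefl (trans (sym block-k) same) 1≤block)
    where
    1≤block : 1 ≤ block (k + suc (suc x))
    1≤block = subst (1 ≤_) (sym (cong (λ y → ⌊ y /2⌋ ⊓ k) (ℕ.m+n∸m≡n k (suc (suc x)))))
                (ℕ.⊓-glb (s≤s z≤n) (ℕ.≤-trans (s≤s z≤n) 2≤k))

  degree-member₀ : degree graph member₀ ≡ suc k
  degree-member₀ = begin-equality
    degree graph member₀                                       ≡⟨ degree≡count member₀ ⟩
    count n (adjacency (toℕ member₀))
      ≡⟨ cong (λ i → count n (adjacency i)) (Fin.toℕ-fromℕ< k<n) ⟩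
    count n (adjacency k)                                       ≡⟨ count-split (adjacency k) k≤n ⟩
    count k (adjacency k) + count (n ∸ k) (λ x → adjacency k (k + x))
      ≡⟨ cong₂ _+_ (count-all (λ i i<k → adjacency-member-hub ℕ.≤-refl i<k))
                   (trans (count-cong {n ∸ k} {λ x → adjacency k (k + x)} {_≡ᵇ 1} adjacency-k)
                          (count-singleton 1 (offset-< k+1<n))) ⟩
    k + 1                                                       ≡⟨ ℕ.+-comm k 1 ⟩
    suc k                                                       ∎

  min-degree : MinDegree≡ graph (suc k)
  min-degree =
    (λ v → [ degree-hub , degree-member ]′ (hub-or-member v)) , member₀ , degree-member₀

  route : ∀ {Q : Fin n → Set} {h u} → Hub h → Member u → Q h → Q u →
          ∀ {s t} → Q s → Q t → PathWithin graph Q s t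
  route {h = h} {u} hub-h member-u Qh Qu {s} {t} Qs Qt
    with hub-or-member s | hub-or-member t
  ... | inj₁ hub-s    | inj₁ hub-t    = s ∷ u ∷ t ∷ [] ,
          adjacent (adjacency-hub-member hub-s member-u) ∷
          adjacent (adjacency-member-hub member-u hub-t) ∷ [-] t ,
          refl , refl , Qs ∷ Qu ∷ Qt ∷ []
  ... | inj₁ hub-s    | inj₂ member-t = s ∷ t ∷ [] ,
          adjacent (adjacency-hub-member hub-s member-t) ∷ [-] t ,
          refl , refl , Qs ∷ Qt ∷ []
  ... | inj₂ member-s | inj₁ hub-t    = s ∷ t ∷ [] ,
          adjacent (adjacency-member-hub member-s hub-t) ∷ [-] t ,
          refl , refl , Qs ∷ Qt ∷ []
  ... | inj₂ member-s | inj₂ member-t = s ∷ h ∷ t ∷ [] ,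
          adjacent (adjacency-member-hub member-s hub-h) ∷
          adjacent (adjacency-hub-member hub-h member-t) ∷ [-] t ,
          refl , refl , Qs ∷ Qh ∷ Qt ∷ []

  fromℕ<-≢ : ∀ {i j} (i<n : i < n) (j<n : j < n) → i ≢ j → fromℕ< i<n ≢ fromℕ< j<n
  fromℕ<-≢ {i} {j} i<n j<n i≢j = i≢j ∘ Fin.fromℕ<-injective i j i<n j<n

  0<n : 0 < n
  0<n = ℕ.<-trans (ℕ.≤-trans (s≤s z≤n) 2≤k) k<n

  1<n : 1 < n
  1<n = ℕ.<-trans 2≤k k<n

  hub₀ hub₁ : Fin n
  hub₀ = fromℕ< 0<n
  hub₁ = fromℕ< 1<n

  hub₀-hub : Hub hub₀
  hub₀-hub = subst (_< k) (sym (Fin.toℕ-fromℕ< _)) (ℕ.≤-trans (s≤s z≤n) 2≤k)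

  hub₁-hub : Hub hub₁
  hub₁-hub = subst (_< k) (sym (Fin.toℕ-fromℕ< _)) 2≤k

  member₀-member : Member member₀
  member₀-member = subst (k ≤_) (sym (Fin.toℕ-fromℕ< k<n)) ℕ.≤-refl

  member₁-member : Member member₁
  member₁-member = subst (k ≤_) (sym (Fin.toℕ-fromℕ< k+1<n)) (ℕ.m≤m+n k 1)

  two-connected : TwoConnected graph
  two-connected = ℕ.≤-trans (s≤s 2≤k) k<n , connected , avoiding
    where
    connected : Connected graph
    connected s t = PathWithin⇒Path (route {Q = λ _ → ⊤} hub₀-hub member₀-member tt tt tt tt)
    avoiding : ∀ x s t → s ≢ x → t ≢ x → PathAvoiding graph x s t
    avoiding x s t s≢x t≢x
      with one-avoids Fin._≟_ hub₀-hub hub₁-hub (fromℕ<-≢ 0<n 1<n λ ()) x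
         | one-avoids Fin._≟_ member₀-member member₁-member
                      (fromℕ<-≢ k<n k+1<n (ℕ.m+1+n≢m k ∘ sym)) x
    ... | h , hub-h , x≢h | u , member-u , x≢u =
      PathWithin⇒PathAvoiding (route hub-h member-u x≢h x≢u (s≢x ∘ sym) (t≢x ∘ sym))

  role : Fin n → Fin (suc k) ⊎ Fin k
  role v with toℕ v <? k
  ... | yes v<k = inj₂ (fromℕ< v<k)
  ... | no  _   = inj₁ (fromℕ< (s≤s (block≤k (toℕ v))))

  role-hub : ∀ {v h} → role v ≡ inj₂ h → toℕ h ≡ toℕ v
  role-hub {v} role≡ with toℕ v <? k
  role-hub refl | yes v<k = Fin.toℕ-fromℕ< v<k
  role-hub ()   | no  _

  role-block : ∀ {v b} → role v ≡ inj₁ b → k ≤ toℕ v × toℕ b ≡ block (toℕ v)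
  role-block {v} role≡ with toℕ v <? k
  role-block ()   | yes _
  role-block refl | no  v≮k = ℕ.≮⇒≥ v≮k , Fin.toℕ-fromℕ< _

  role-member : ∀ {v b} → k ≤ toℕ v → toℕ b ≡ block (toℕ v) → role v ≡ inj₁ b
  role-member {v} k≤v b≡ with toℕ v <? k
  ... | yes v<k = ⊥-elim (ℕ.<⇒≱ v<k k≤v)
  ... | no  _   = cong inj₁ (Fin.toℕ-injective (trans (Fin.toℕ-fromℕ< _) (sym b≡)))

  partition : HubBlockPartition graph k
  partition = record
    { role         = role
    ; hub-unique   = λ u≡h v≡h → Fin.toℕ-injective (trans (sym (role-hub u≡h)) (role-hub v≡h))
    ; block-closed = block-closed
    ; block-edge   = block-edge
    }
    where
    block-closed : ∀ {u v b c} → role u ≡ inj₁ b → role v ≡ inj₁ c → Adj graph u v → b ≡ c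
    block-closed u∈b v∈c uv with role-block u∈b | role-block v∈c
    ... | k≤u , b≡ | k≤v , c≡ =
      Fin.toℕ-injective (trans b≡ (trans (adjacent-members-same-block k≤u k≤v uv) (sym c≡)))

    block-edge : ∀ b → ∃₂ λ u v → role u ≡ inj₁ b × role v ≡ inj₁ b × Adj graph u v
    block-edge b = fromℕ< (pair₀<n b≤k) , fromℕ< (pair₁<n b≤k) ,
                   in-block (pair₀<n b≤k) (block-pair₀ b≤k) ,
                   in-block (pair₁<n b≤k) (block-pair₁ b≤k) , edge
      where
      b≤k : toℕ b ≤ k
      b≤k = s≤s⁻¹ (Fin.toℕ<n b)
      in-block : ∀ {x} (x<n : k + x < n) → block (k + x) ≡ toℕ b → role (fromℕ< x<n) ≡ inj₁ b
      in-block {x} x<n block≡ =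
        role-member (subst (k ≤_) (sym (Fin.toℕ-fromℕ< x<n)) (ℕ.m≤m+n k x))
                    (sym (trans (cong block (Fin.toℕ-fromℕ< x<n)) block≡))
      edge : Adj graph (fromℕ< (pair₀<n b≤k)) (fromℕ< (pair₁<n b≤k))
      edge rewrite Fin.toℕ-fromℕ< (pair₀<n b≤k) | Fin.toℕ-fromℕ< (pair₁<n b≤k) =
        Equivalence.from T-≡
          (adjacency-same-block (ℕ.m≤m+n k _) (ℕ.m≤m+n k _) (pair₀≢pair₁ {toℕ b})
                                (trans (block-pair₀ b≤k) (sym (block-pair₁ b≤k))))

3[1+k]<n+2⇒k+1+2k<n : ∀ k n → 3 * suc k < n + 2 → k + suc (k + k) < n
3[1+k]<n+2⇒k+1+2k<n k n lt = ℕ.+-cancelʳ-≤ 2 _ n (subst (_≤ n + 2) (shape k) lt)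
  where
  shape : ∀ k → suc (3 * suc k) ≡ suc (k + suc (k + k)) + 2
  shape = solve-∀

-- The hypothesis 8 ≤ n is implied by the other two.
claim6 : ∀ (n ν : ℕ) → 8 ≤ n → 2 < ν → 3 * ν < n + 2 →
    Σ (Graph n) λ G → TwoConnected G × MinDegree≡ G ν ×
      (∀ (W : List (Fin n)) → IsCycle G W → ¬ Independent G (λ v → v ∉ W))
claim6 n zero    _ () _
claim6 n (suc k) _ (s≤s 2≤k@(s≤s (s≤s z≤n))) 3ν<n+2 =
  graph , two-connected , min-degree , no-dominating-cycle partition
  where
  open Construction k n 2≤k (3[1+k]<n+2⇒k+1+2k<n k n 3ν<n+2)
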